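{- For any circle graph $G$, $\psi(G) \le \alpha(G) + 1$.
   Context: A circle graph is the intersection graph of a finite set of chords of a circle. For $k \ge 3$, a $k$-polygon graph is the intersection graph of a finite set of chords of a convex $k$-sided polygon with each chord having its endpoints on two distinct sides; $2$-polygon graphs are the permutation graphs. The polygon number $\psi(G)$ of a circle graph $G$ is the minimum $k\ge 2$ such that $G$ is a $k$-polygon graph. $\alpha(G)$ is the size of a maximum independent set of $G$. -}

module Defs where

open import Data.Nat using (ℕ; _<_; _≤_)
open import Data.Fin using (Fin)
open import Data.Fin.Subset using (Subset; _∈_; ∣_∣)
open import Data.Bool using (Bool; true; false)
open import Data.Product using (_×_; Σ; ∃)
open import Data.Sum using (_⊎_)
open import Relation.Binary.PropositionalEquality using (_≡_; _≢_)
open import Relation.Nullary using (¬_)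
open import Function.Bundles using (_⇔_)

Graph : ℕ → Set₁
Graph n = Fin n → Fin n → Set

-- The circle is cut at a
-- point (not an endpoint) and its points are then linearly ordered; positions are
-- natural numbers.
record ChordModel (n : ℕ) : Set where
  field
    pos      : Fin n → Bool → ℕ
    ordered  : ∀ i → pos i false < pos i true
    distinct : ∀ i b j c → pos i b ≡ pos j c → (i ≡ j) × (b ≡ c)

  left right : Fin n → ℕ
  left  i = pos i false
  right i = pos i true

  Cross : Fin n → Fin n → Set
  Cross i j = (left i < left j × left j < right i × right i < right j)
            ⊎ (left j < left i × left i < right j × right j < right i)

Represents : ∀ {n} → ChordModel n → Graph n → Set
Represents {n} M G = ∀ (i j : Fin n) → G i j ⇔ ChordModel.Cross M i j

IsCircleGraph : ∀ {n} → Graph n → Set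
IsCircleGraph G = Σ (ChordModel _) λ M → Represents M G

-- A k-polygon model: chords whose endpoints lie on the boundary of a convex
-- k-gon.  Cutting the boundary at a corner, the k sides become consecutive
-- intervals of the linear order, numbered 0,…,k-1: side is monotone with values
-- < k.
record PolygonModel (k n : ℕ) : Set where
  field
    chords    : ChordModel n
    side      : ℕ → ℕ
    side-mono : ∀ {p q} → p ≤ q → side p ≤ side q
    side-<k   : ∀ p → side p < k
    two-sides : ∀ i → side (ChordModel.left chords i) ≢ side (ChordModel.right chords i)

IsPolygonGraph : ℕ → ∀ {n} → Graph n → Set
IsPolygonGraph k G = Σ (PolygonModel k _) λ P → Represents (PolygonModel.chords P) G

Independent : ∀ {n} → Graph n → Subset n → Set
Independent G S = ∀ i j → i ∈ S → j ∈ S → ¬ G i j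

IsIndependenceNumber : ∀ {n} → Graph n → ℕ → Set
IsIndependenceNumber {n} G a =
  (Σ (Subset n) λ S → Independent G S × ∣ S ∣ ≡ a)
  × (∀ S → Independent G S → ∣ S ∣ ≤ a)

-- ψ(G) ≤ m, unfolding ψ(G) = min { k ≥ 2 | G is a k-polygon graph }
PolygonNumber≤ : ∀ {n} → Graph n → ℕ → Set
PolygonNumber≤ G m = ∃ λ k → 2 ≤ k × k ≤ m × IsPolygonGraph k G

-- Scan the cut circle from left to right and start a new side exactly when some
-- chord that begins on the current side ends at the current point.  Every chord
-- then has its endpoints on distinct sides: when its right endpoint is reached,
-- either a side starts there or its left endpoint already lies on an earlier side.
-- The chords that triggered new sides follow one another along the circle, so
-- they pairwise do not cross, and hence there are at most α + 1 sides.
module Submission where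

open import Defs
open import Data.Nat using (ℕ; zero; suc; _≤_; _<_; _≤′_; ≤′-refl; ≤′-step; z≤n; s≤s)
open import Data.Nat.Properties
  using (_≟_; _≤?_; ≤-refl; ≤-trans; ≤-reflexive; <⇒≤; <-irrefl; <-trans; <-≤-trans; ≤-pred; n≤1+n; n≮0; ≰⇒>; ≤⇒≤′)
import Data.Fin as Fin
open import Data.Fin.Subset using (Subset; _∈_; _∉_; ∣_∣; ⊥; _∪_; ⁅_⁆)
open import Data.Fin.Subset.Properties using (∉⊥; p⊆p∪q; q⊆p∪q; x∈p∪q⁻; x∈⁅x⁆; x∈⁅y⁆⇒x≡y; ∣⁅x⁆∣≡1; p⊂q⇒∣p∣<∣q∣)
open import Data.Fin.Properties using (any?)
open import Data.Product using (_×_; ∃; _,_; proj₁; proj₂)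
open import Data.Sum using (inj₁; inj₂)
open import Data.Empty using (⊥-elim)
open import Relation.Nullary using (¬_; Dec; yes; no)
open import Relation.Nullary.Decidable using (_×-dec_)
open import Relation.Binary.PropositionalEquality using (_≡_; refl; subst)
open import Function.Bundles using (Equivalence)

x∉p⇒∣p∣<∣p∪⁅x⁆∣ : ∀ {n} {p : Subset n} {x} → x ∉ p → ∣ p ∣ < ∣ p ∪ ⁅ x ⁆ ∣
x∉p⇒∣p∣<∣p∪⁅x⁆∣ {p = p} {x} x∉p = p⊂q⇒∣p∣<∣q∣ (p⊆p∪q ⁅ x ⁆ , x , q⊆p∪q p ⁅ x ⁆ (x∈⁅x⁆ x) , x∉p)

module Chords {n : ℕ} (M : ChordModel n) where
  open ChordModel M

  Cross-irrefl : ∀ i → ¬ Cross i i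
  Cross-irrefl i (inj₁ (l<l , _ , _)) = <-irrefl refl l<l
  Cross-irrefl i (inj₂ (l<l , _ , _)) = <-irrefl refl l<l

  Cross-sym : ∀ {i j} → Cross i j → Cross j i
  Cross-sym (inj₁ interleave) = inj₂ interleave
  Cross-sym (inj₂ interleave) = inj₁ interleave

  right≤left⇒¬Cross : ∀ {i j} → right j ≤ left i → ¬ Cross j i
  right≤left⇒¬Cross rj≤li (inj₁ (_ , li<rj , _)) = <-irrefl refl (<-≤-trans li<rj rj≤li)
  right≤left⇒¬Cross {i} rj≤li (inj₂ (_ , _ , rj<ri)) =
    <-irrefl refl (<-trans (<-≤-trans rj<ri rj≤li) (ordered i))

  Independent-⁅⁆ : ∀ i → Independent Cross ⁅ i ⁆
  Independent-⁅⁆ i j k j∈ k∈ with x∈⁅y⁆⇒x≡y i j∈ | x∈⁅y⁆⇒x≡y i k∈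
  ... | refl | refl = Cross-irrefl i

  Independent-∪⁅⁆ : ∀ {S i} → Independent Cross S → (∀ j → j ∈ S → right j ≤ left i) →
                    Independent Cross (S ∪ ⁅ i ⁆)
  Independent-∪⁅⁆ {S} {i} indS before j k j∈ k∈ with x∈p∪q⁻ S ⁅ i ⁆ j∈ | x∈p∪q⁻ S ⁅ i ⁆ k∈
  ... | inj₁ j∈S | inj₁ k∈S = indS j k j∈S k∈S
  ... | inj₁ j∈S | inj₂ k∈i with x∈⁅y⁆⇒x≡y i k∈i
  ...   | refl = right≤left⇒¬Cross (before j j∈S)
  Independent-∪⁅⁆ {S} {i} indS before j k j∈ k∈ | inj₂ j∈i | inj₁ k∈S with x∈⁅y⁆⇒x≡y i j∈i
  ...   | refl = λ crosses → right≤left⇒¬Cross (before k k∈S) (Cross-sym crosses)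
  Independent-∪⁅⁆ {S} {i} indS before j k j∈ k∈ | inj₂ j∈i | inj₂ k∈i =
    Independent-⁅⁆ i j k j∈i k∈i

module Greedy {n : ℕ} (M : ChordModel n) where
  open ChordModel M
  open Chords M

  ClosesAt : ℕ → ℕ → Set
  ClosesAt c q = ∃ λ i → c ≤ left i × right i ≡ q

  closesAt? : ∀ c q → Dec (ClosesAt c q)
  closesAt? c q = any? λ i → (c ≤? left i) ×-dec (right i ≟ q)

  -- scan p = (start of the current side, number of sides started) after reading 0,…,p
  scan : ℕ → ℕ × ℕ
  scan zero    = 0 , 0
  scan (suc p) = next (closesAt? (proj₁ (scan p)) (suc p))
    where
    next : Dec (ClosesAt (proj₁ (scan p)) (suc p)) → ℕ × ℕ
    next (yes _) = suc p , suc (proj₂ (scan p))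
    next (no _)  = scan p

  start side : ℕ → ℕ
  start p = proj₁ (scan p)
  side  p = proj₂ (scan p)

  side-≤-suc : ∀ p → side p ≤ side (suc p)
  side-≤-suc p with closesAt? (start p) (suc p)
  ... | yes _ = n≤1+n (side p)
  ... | no _  = ≤-refl

  side-mono : ∀ {p q} → p ≤ q → side p ≤ side q
  side-mono p≤q = go (≤⇒≤′ p≤q)
    where
    go : ∀ {p q} → p ≤′ q → side p ≤ side q
    go ≤′-refl           = ≤-refl
    go (≤′-step {q} p≤q) = ≤-trans (go p≤q) (side-≤-suc q)

  <start⇒side< : ∀ p {q} → q < start p → side q < side p
  <start⇒side< (suc p) q<start with closesAt? (start p) (suc p)
  ... | yes _ = s≤s (side-mono (≤-pred q<start))
  ... | no _  = <start⇒side< p q<start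

  side-left<side-right : ∀ i → side (left i) < side (right i)
  side-left<side-right i = go (right i) refl
    where
    go : ∀ r → right i ≡ r → side (left i) < side r
    go zero    ri≡0 = ⊥-elim (n≮0 (subst (left i <_) ri≡0 (ordered i)))
    go (suc p) ri≡r with closesAt? (start p) (suc p)
    ... | yes _ = s≤s (side-mono (≤-pred (subst (left i <_) ri≡r (ordered i))))
    ... | no ¬closes with start p ≤? left i
    ...   | yes start≤li = ⊥-elim (¬closes (i , start≤li , ri≡r))
    ...   | no start≰li  = <start⇒side< p (≰⇒> start≰li)

  record Triggers (s k : ℕ) : Set where
    field
      chosen            : Subset n
      independent       : Independent Cross chosen
      k≤∣chosen∣        : k ≤ ∣ chosen ∣
      ends-before-start : ∀ j → j ∈ chosen → right j ≤ s

  triggers : ∀ p → Triggers (start p) (side p)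
  triggers zero = record
    { chosen            = ⊥
    ; independent       = λ j _ j∈⊥ _ → ⊥-elim (∉⊥ j∈⊥)
    ; k≤∣chosen∣        = z≤n
    ; ends-before-start = λ j j∈⊥ → ⊥-elim (∉⊥ j∈⊥)
    }
  triggers (suc p) with triggers p | closesAt? (start p) (suc p)
  ... | T | no _ = T
  ... | T | yes (i , start≤li , ri≡p+1) = record
    { chosen            = chosen ∪ ⁅ i ⁆
    ; independent       = Independent-∪⁅⁆ independent ends-before-i
    ; k≤∣chosen∣        = ≤-trans (s≤s k≤∣chosen∣) (x∉p⇒∣p∣<∣p∪⁅x⁆∣ i∉chosen)
    ; ends-before-start = ends-before-p+1
    }
    where
    open Triggers T
    ends-before-i : ∀ j → j ∈ chosen → right j ≤ left i
    ends-before-i j j∈ = ≤-trans (ends-before-start j j∈) start≤li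
    i∉chosen : i ∉ chosen
    i∉chosen i∈ = <-irrefl refl (<-≤-trans (ordered i) (ends-before-i i i∈))
    ends-before-p+1 : ∀ j → j ∈ chosen ∪ ⁅ i ⁆ → right j ≤ suc p
    ends-before-p+1 j j∈ with x∈p∪q⁻ chosen ⁅ i ⁆ j∈
    ... | inj₁ j∈chosen = ≤-trans (ends-before-i j j∈chosen) (≤-trans (<⇒≤ (ordered i)) (≤-reflexive ri≡p+1))
    ... | inj₂ j∈i with x∈⁅y⁆⇒x≡y i j∈i
    ...   | refl = ≤-reflexive ri≡p+1

  polygonModel : ∀ {a} → (∀ S → Independent Cross S → ∣ S ∣ ≤ a) → PolygonModel (suc a) n
  polygonModel {a} bounded = record
    { chords    = M
    ; side      = side
    ; side-mono = side-mono
    ; side-<k   = side<1+a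
    ; two-sides = λ i same → <-irrefl same (side-left<side-right i)
    }
    where
    side<1+a : ∀ p → side p < suc a
    side<1+a p = s≤s (≤-trans k≤∣chosen∣ (bounded chosen independent))
      where open Triggers (triggers p)

Represents⇒Independent : ∀ {n} {M : ChordModel n} {G : Graph n} → Represents M G →
                         ∀ {S} → Independent (ChordModel.Cross M) S → Independent G S
Represents⇒Independent M⇔G indM i j i∈ j∈ adjacent = indM i j i∈ j∈ (Equivalence.to (M⇔G i j) adjacent)

circle⇒polygon : ∀ {n} {G : Graph n} {a} → IsCircleGraph G →
                 (∀ S → Independent G S → ∣ S ∣ ≤ a) → IsPolygonGraph (suc a) G
circle⇒polygon (M , M⇔G) bounded =
  Greedy.polygonModel M (λ S indM → bounded S (Represents⇒Independent {M = M} M⇔G indM)) , M⇔G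

circle⇒1≤α : ∀ {n} {G : Graph (suc n)} {a} → IsCircleGraph G →
             (∀ S → Independent G S → ∣ S ∣ ≤ a) → 1 ≤ a
circle⇒1≤α {n} {a = a} (M , M⇔G) bounded =
  subst (_≤ a) (∣⁅x⁆∣≡1 {suc n} Fin.zero)
    (bounded ⁅ Fin.zero ⁆ (Represents⇒Independent {M = M} M⇔G (Chords.Independent-⁅⁆ M Fin.zero)))

corollary2 : ∀ (n : ℕ) (G : Graph n) (α : ℕ) → 1 ≤ n → IsCircleGraph G → IsIndependenceNumber G α → PolygonNumber≤ G (suc α)
corollary2 (suc _) _ α _ circle (_ , α-max) =
  suc α , s≤s (circle⇒1≤α circle α-max) , ≤-refl , circle⇒polygon circle α-max
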